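{- Let $\varphi$ be a quantifier-free $\mathcal{T}$-formula which is $\mathcal{T}$-extended with respect to a finite set of atoms $\boldsymbol{\alpha}$ containing its atoms, and let $l$ be a literal on $\boldsymbol{\alpha}$. Then both $\neg l\vee\varphi|_{l}$ and $\neg l\vee(\varphi|_{l}\wedge l)$ are $\mathcal{T}$-extended with respect to $\boldsymbol{\alpha}$.
   Context: $\mathcal{T}$-formulas are quantifier-free formulas built by Boolean connectives from $\mathcal{T}$-atoms and Boolean atoms. $\varphi|_{l}$ (residual of $\varphi$ under $l$) is the formula obtained by substituting in $\varphi$ the atom of $l$ by the truth constant making $l$ true and propagating constants in the standard way. $\psi\models_p\chi$ means the Boolean abstraction (atoms mapped bijectively to Boolean variables) of $\psi$ propositionally entails that of $\chi$. A total truth assignment on $\boldsymbol{\alpha}$ is a conjunction containing, for each $a\in\boldsymbol{\alpha}$, exactly one of $a,\neg a$. $P_{\boldsymbol{\alpha}}(\psi)$ is the set of $\mathcal{T}$-unsatisfiable total truth assignments $\rho$ on $\boldsymbol{\alpha}$ with $\rho\models_p\psi$; $\psi$ is $\mathcal{T}$-extended with respect to $\boldsymbol{\alpha}$ iff $P_{\boldsymbol{\alpha}}(\neg\psi)=\emptyset$. -}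

module Defs where

open import Data.Bool using (Bool; true; false; not; _∧_; _∨_; if_then_else_)
open import Data.List using (List; []; _∷_; _++_; foldr)
open import Data.List.Membership.Propositional using (_∈_)
open import Data.List.Relation.Unary.All using (All)
open import Data.Product using (Σ; _×_; _,_)
open import Relation.Binary.PropositionalEquality using (_≡_)
open import Relation.Binary.Definitions using (DecidableEquality)
open import Relation.Nullary using (¬_; yes; no)

-- A theory T is abstracted by the set of valuations of the atoms
-- (T-atoms and Boolean atoms alike, collected in the type Atom) that are
-- induced by some T-interpretation.
Theory : Set → Set₁
Theory Atom = (Atom → Bool) → Set

data Formula (Atom : Set) : Set where
  atom  : Atom → Formula Atom
  ⊤f ⊥f : Formula Atom
  ¬f_   : Formula Atom → Formula Atom
  _∧f_ _∨f_ _⇒f_ _⇔f_ : Formula Atom → Formula Atom → Formula Atom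

infix  30 ¬f_
infixr 20 _∧f_
infixr 15 _∨f_
infixr 10 _⇒f_ _⇔f_

module _ {Atom : Set} where

  eval : (Atom → Bool) → Formula Atom → Bool
  eval v (atom a) = v a
  eval v ⊤f = true
  eval v ⊥f = false
  eval v (¬f φ) = not (eval v φ)
  eval v (φ ∧f ψ) = eval v φ ∧ eval v ψ
  eval v (φ ∨f ψ) = eval v φ ∨ eval v ψ
  eval v (φ ⇒f ψ) = not (eval v φ) ∨ eval v ψ
  eval v (φ ⇔f ψ) = if eval v φ then eval v ψ else not (eval v ψ)

  atoms : Formula Atom → List Atom
  atoms (atom a) = a ∷ []
  atoms ⊤f = []
  atoms ⊥f = []
  atoms (¬f φ) = atoms φ
  atoms (φ ∧f ψ) = atoms φ ++ atoms ψ
  atoms (φ ∨f ψ) = atoms φ ++ atoms ψ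
  atoms (φ ⇒f ψ) = atoms φ ++ atoms ψ
  atoms (φ ⇔f ψ) = atoms φ ++ atoms ψ

  _⊨p_ : Formula Atom → Formula Atom → Set
  ψ ⊨p χ = ∀ (w : Atom → Bool) → eval w ψ ≡ true → eval w χ ≡ true

  TSat : Theory Atom → Formula Atom → Set
  TSat T φ = Σ (Atom → Bool) λ M → T M × (eval M φ ≡ true)

  litF : Atom → Bool → Formula Atom
  litF a true = atom a
  litF a false = ¬f atom a

  assignment : List Atom → (Atom → Bool) → Formula Atom
  assignment α v = foldr (λ a acc → litF a (v a) ∧f acc) ⊤f α

  IsTotalAssignment : List Atom → Formula Atom → Set
  IsTotalAssignment α ρ = Σ (Atom → Bool) λ v → ρ ≡ assignment α v

  InP : Theory Atom → List Atom → Formula Atom → Formula Atom → Set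
  InP T α ψ ρ = IsTotalAssignment α ρ × ¬ TSat T ρ × (ρ ⊨p ψ)

  TExtended : Theory Atom → List Atom → Formula Atom → Set
  TExtended T α ψ = ∀ ρ → ¬ InP T α (¬f ψ) ρ

  record Literal (α : List Atom) : Set where
    constructor mkLit
    field
      litAtom : Atom
      polarity : Bool
      litAtom∈α : litAtom ∈ α
  open Literal public

  toFormula : ∀ {α} → Literal α → Formula Atom
  toFormula l = litF (litAtom l) (polarity l)

  negLit : ∀ {α} → Literal α → Formula Atom
  negLit l = litF (litAtom l) (not (polarity l))

  sNot : Formula Atom → Formula Atom
  sNot ⊤f = ⊥f
  sNot ⊥f = ⊤f
  sNot φ = ¬f φ

  sAnd : Formula Atom → Formula Atom → Formula Atom
  sAnd ⊥f ψ = ⊥f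
  sAnd ⊤f ψ = ψ
  sAnd φ ⊥f = ⊥f
  sAnd φ ⊤f = φ
  sAnd φ ψ = φ ∧f ψ

  sOr : Formula Atom → Formula Atom → Formula Atom
  sOr ⊤f ψ = ⊤f
  sOr ⊥f ψ = ψ
  sOr φ ⊤f = ⊤f
  sOr φ ⊥f = φ
  sOr φ ψ = φ ∨f ψ

  sImp : Formula Atom → Formula Atom → Formula Atom
  sImp ⊥f ψ = ⊤f
  sImp ⊤f ψ = ψ
  sImp φ ⊤f = ⊤f
  sImp φ ⊥f = sNot φ
  sImp φ ψ = φ ⇒f ψ

  sIff : Formula Atom → Formula Atom → Formula Atom
  sIff ⊤f ψ = ψ
  sIff ⊥f ψ = sNot ψ
  sIff φ ⊤f = φ
  sIff φ ⊥f = sNot φ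
  sIff φ ψ = φ ⇔f ψ

  substProp : DecidableEquality Atom → Atom → Bool → Formula Atom → Formula Atom
  substProp _≟_ a b (atom x) with x ≟ a
  ... | yes _ = if b then ⊤f else ⊥f
  ... | no _ = atom x
  substProp _≟_ a b ⊤f = ⊤f
  substProp _≟_ a b ⊥f = ⊥f
  substProp _≟_ a b (¬f φ) = sNot (substProp _≟_ a b φ)
  substProp _≟_ a b (φ ∧f ψ) = sAnd (substProp _≟_ a b φ) (substProp _≟_ a b ψ)
  substProp _≟_ a b (φ ∨f ψ) = sOr (substProp _≟_ a b φ) (substProp _≟_ a b ψ)
  substProp _≟_ a b (φ ⇒f ψ) = sImp (substProp _≟_ a b φ) (substProp _≟_ a b ψ)
  substProp _≟_ a b (φ ⇔f ψ) = sIff (substProp _≟_ a b φ) (substProp _≟_ a b ψ)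

  residual : DecidableEquality Atom → ∀ {α} → Formula Atom → Literal α → Formula Atom
  residual _≟_ φ l = substProp _≟_ (litAtom l) (polarity l) φ

-- For ψ over α, T-extension says exactly that ψ is true at every
-- valuation v whose total assignment on α is T-unsatisfiable: v satisfies
-- that assignment, and any valuation satisfying it agrees with v on the
-- atoms of ψ.  Fix such a v; then φ is true at v.  If v falsifies l, then
-- ¬l holds; otherwise substituting for the atom of l the value it already
-- has at v does not change any truth value, so φ|_l (and l) hold at v.
module Submission where

open import Defs
open import Data.Bool using (Bool; true; false; not; _∧_; _∨_; if_then_else_)
open import Data.Bool.Properties
  using (∧-identityʳ; ∧-zeroʳ; ∨-identityʳ; ∨-zeroʳ; ∧-conicalˡ; ∧-conicalʳ;
         not-involutive; ¬-not; not-¬)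
open import Data.List using (List; []; _∷_)
open import Data.List.Membership.Propositional using (_∈_)
open import Data.List.Relation.Unary.All as All using (All)
open import Data.List.Relation.Unary.All.Properties using (++⁻ˡ; ++⁻ʳ)
open import Data.List.Relation.Unary.Any using (here; there)
open import Data.Product using (_×_; _,_)
open import Relation.Binary.Definitions using (DecidableEquality)
open import Relation.Binary.PropositionalEquality
  using (_≡_; refl; sym; trans; cong; cong₂)
open import Relation.Nullary using (¬_; yes; no)

if-true-false : ∀ b → (if b then true else false) ≡ b
if-true-false true = refl
if-true-false false = refl

if-false-true : ∀ b → (if b then false else true) ≡ not b
if-false-true true = refl
if-false-true false = refl

not-∨-intro : ∀ x {y} → (x ≡ true → y ≡ true) → not x ∨ y ≡ true
not-∨-intro false _ = refl
not-∨-intro true x⇒y = x⇒y refl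

module _ {Atom : Set} where

  eval-sNot : ∀ v (p : Formula Atom) → eval v (sNot p) ≡ not (eval v p)
  eval-sNot v ⊤f = refl
  eval-sNot v ⊥f = refl
  eval-sNot v (atom _) = refl
  eval-sNot v (¬f _) = refl
  eval-sNot v (_ ∧f _) = refl
  eval-sNot v (_ ∨f _) = refl
  eval-sNot v (_ ⇒f _) = refl
  eval-sNot v (_ ⇔f _) = refl

  eval-sAnd : ∀ v (p q : Formula Atom) → eval v (sAnd p q) ≡ eval v p ∧ eval v q
  eval-sAnd v ⊥f q = refl
  eval-sAnd v ⊤f q = refl
  eval-sAnd v (atom _) ⊤f = sym (∧-identityʳ _)
  eval-sAnd v (atom _) ⊥f = sym (∧-zeroʳ _)
  eval-sAnd v (atom _) (atom _) = refl
  eval-sAnd v (atom _) (¬f _) = refl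
  eval-sAnd v (atom _) (_ ∧f _) = refl
  eval-sAnd v (atom _) (_ ∨f _) = refl
  eval-sAnd v (atom _) (_ ⇒f _) = refl
  eval-sAnd v (atom _) (_ ⇔f _) = refl
  eval-sAnd v (¬f _) ⊤f = sym (∧-identityʳ _)
  eval-sAnd v (¬f _) ⊥f = sym (∧-zeroʳ _)
  eval-sAnd v (¬f _) (atom _) = refl
  eval-sAnd v (¬f _) (¬f _) = refl
  eval-sAnd v (¬f _) (_ ∧f _) = refl
  eval-sAnd v (¬f _) (_ ∨f _) = refl
  eval-sAnd v (¬f _) (_ ⇒f _) = refl
  eval-sAnd v (¬f _) (_ ⇔f _) = refl
  eval-sAnd v (_ ∧f _) ⊤f = sym (∧-identityʳ _)
  eval-sAnd v (_ ∧f _) ⊥f = sym (∧-zeroʳ _)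
  eval-sAnd v (_ ∧f _) (atom _) = refl
  eval-sAnd v (_ ∧f _) (¬f _) = refl
  eval-sAnd v (_ ∧f _) (_ ∧f _) = refl
  eval-sAnd v (_ ∧f _) (_ ∨f _) = refl
  eval-sAnd v (_ ∧f _) (_ ⇒f _) = refl
  eval-sAnd v (_ ∧f _) (_ ⇔f _) = refl
  eval-sAnd v (_ ∨f _) ⊤f = sym (∧-identityʳ _)
  eval-sAnd v (_ ∨f _) ⊥f = sym (∧-zeroʳ _)
  eval-sAnd v (_ ∨f _) (atom _) = refl
  eval-sAnd v (_ ∨f _) (¬f _) = refl
  eval-sAnd v (_ ∨f _) (_ ∧f _) = refl
  eval-sAnd v (_ ∨f _) (_ ∨f _) = refl
  eval-sAnd v (_ ∨f _) (_ ⇒f _) = refl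
  eval-sAnd v (_ ∨f _) (_ ⇔f _) = refl
  eval-sAnd v (_ ⇒f _) ⊤f = sym (∧-identityʳ _)
  eval-sAnd v (_ ⇒f _) ⊥f = sym (∧-zeroʳ _)
  eval-sAnd v (_ ⇒f _) (atom _) = refl
  eval-sAnd v (_ ⇒f _) (¬f _) = refl
  eval-sAnd v (_ ⇒f _) (_ ∧f _) = refl
  eval-sAnd v (_ ⇒f _) (_ ∨f _) = refl
  eval-sAnd v (_ ⇒f _) (_ ⇒f _) = refl
  eval-sAnd v (_ ⇒f _) (_ ⇔f _) = refl
  eval-sAnd v (_ ⇔f _) ⊤f = sym (∧-identityʳ _)
  eval-sAnd v (_ ⇔f _) ⊥f = sym (∧-zeroʳ _)
  eval-sAnd v (_ ⇔f _) (atom _) = refl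
  eval-sAnd v (_ ⇔f _) (¬f _) = refl
  eval-sAnd v (_ ⇔f _) (_ ∧f _) = refl
  eval-sAnd v (_ ⇔f _) (_ ∨f _) = refl
  eval-sAnd v (_ ⇔f _) (_ ⇒f _) = refl
  eval-sAnd v (_ ⇔f _) (_ ⇔f _) = refl

  eval-sOr : ∀ v (p q : Formula Atom) → eval v (sOr p q) ≡ eval v p ∨ eval v q
  eval-sOr v ⊤f q = refl
  eval-sOr v ⊥f q = refl
  eval-sOr v (atom _) ⊤f = sym (∨-zeroʳ _)
  eval-sOr v (atom _) ⊥f = sym (∨-identityʳ _)
  eval-sOr v (atom _) (atom _) = refl
  eval-sOr v (atom _) (¬f _) = refl
  eval-sOr v (atom _) (_ ∧f _) = refl
  eval-sOr v (atom _) (_ ∨f _) = refl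
  eval-sOr v (atom _) (_ ⇒f _) = refl
  eval-sOr v (atom _) (_ ⇔f _) = refl
  eval-sOr v (¬f _) ⊤f = sym (∨-zeroʳ _)
  eval-sOr v (¬f _) ⊥f = sym (∨-identityʳ _)
  eval-sOr v (¬f _) (atom _) = refl
  eval-sOr v (¬f _) (¬f _) = refl
  eval-sOr v (¬f _) (_ ∧f _) = refl
  eval-sOr v (¬f _) (_ ∨f _) = refl
  eval-sOr v (¬f _) (_ ⇒f _) = refl
  eval-sOr v (¬f _) (_ ⇔f _) = refl
  eval-sOr v (_ ∧f _) ⊤f = sym (∨-zeroʳ _)
  eval-sOr v (_ ∧f _) ⊥f = sym (∨-identityʳ _)
  eval-sOr v (_ ∧f _) (atom _) = refl
  eval-sOr v (_ ∧f _) (¬f _) = refl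
  eval-sOr v (_ ∧f _) (_ ∧f _) = refl
  eval-sOr v (_ ∧f _) (_ ∨f _) = refl
  eval-sOr v (_ ∧f _) (_ ⇒f _) = refl
  eval-sOr v (_ ∧f _) (_ ⇔f _) = refl
  eval-sOr v (_ ∨f _) ⊤f = sym (∨-zeroʳ _)
  eval-sOr v (_ ∨f _) ⊥f = sym (∨-identityʳ _)
  eval-sOr v (_ ∨f _) (atom _) = refl
  eval-sOr v (_ ∨f _) (¬f _) = refl
  eval-sOr v (_ ∨f _) (_ ∧f _) = refl
  eval-sOr v (_ ∨f _) (_ ∨f _) = refl
  eval-sOr v (_ ∨f _) (_ ⇒f _) = refl
  eval-sOr v (_ ∨f _) (_ ⇔f _) = refl
  eval-sOr v (_ ⇒f _) ⊤f = sym (∨-zeroʳ _)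
  eval-sOr v (_ ⇒f _) ⊥f = sym (∨-identityʳ _)
  eval-sOr v (_ ⇒f _) (atom _) = refl
  eval-sOr v (_ ⇒f _) (¬f _) = refl
  eval-sOr v (_ ⇒f _) (_ ∧f _) = refl
  eval-sOr v (_ ⇒f _) (_ ∨f _) = refl
  eval-sOr v (_ ⇒f _) (_ ⇒f _) = refl
  eval-sOr v (_ ⇒f _) (_ ⇔f _) = refl
  eval-sOr v (_ ⇔f _) ⊤f = sym (∨-zeroʳ _)
  eval-sOr v (_ ⇔f _) ⊥f = sym (∨-identityʳ _)
  eval-sOr v (_ ⇔f _) (atom _) = refl
  eval-sOr v (_ ⇔f _) (¬f _) = refl
  eval-sOr v (_ ⇔f _) (_ ∧f _) = refl
  eval-sOr v (_ ⇔f _) (_ ∨f _) = refl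
  eval-sOr v (_ ⇔f _) (_ ⇒f _) = refl
  eval-sOr v (_ ⇔f _) (_ ⇔f _) = refl

  eval-sImp : ∀ v (p q : Formula Atom) → eval v (sImp p q) ≡ not (eval v p) ∨ eval v q
  eval-sImp v ⊥f q = refl
  eval-sImp v ⊤f q = refl
  eval-sImp v (atom _) ⊤f = sym (∨-zeroʳ _)
  eval-sImp v (atom _) ⊥f = sym (∨-identityʳ _)
  eval-sImp v (atom _) (atom _) = refl
  eval-sImp v (atom _) (¬f _) = refl
  eval-sImp v (atom _) (_ ∧f _) = refl
  eval-sImp v (atom _) (_ ∨f _) = refl
  eval-sImp v (atom _) (_ ⇒f _) = refl
  eval-sImp v (atom _) (_ ⇔f _) = refl
  eval-sImp v (¬f _) ⊤f = sym (∨-zeroʳ _)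
  eval-sImp v (¬f _) ⊥f = sym (∨-identityʳ _)
  eval-sImp v (¬f _) (atom _) = refl
  eval-sImp v (¬f _) (¬f _) = refl
  eval-sImp v (¬f _) (_ ∧f _) = refl
  eval-sImp v (¬f _) (_ ∨f _) = refl
  eval-sImp v (¬f _) (_ ⇒f _) = refl
  eval-sImp v (¬f _) (_ ⇔f _) = refl
  eval-sImp v (_ ∧f _) ⊤f = sym (∨-zeroʳ _)
  eval-sImp v (_ ∧f _) ⊥f = sym (∨-identityʳ _)
  eval-sImp v (_ ∧f _) (atom _) = refl
  eval-sImp v (_ ∧f _) (¬f _) = refl
  eval-sImp v (_ ∧f _) (_ ∧f _) = refl
  eval-sImp v (_ ∧f _) (_ ∨f _) = refl
  eval-sImp v (_ ∧f _) (_ ⇒f _) = refl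
  eval-sImp v (_ ∧f _) (_ ⇔f _) = refl
  eval-sImp v (_ ∨f _) ⊤f = sym (∨-zeroʳ _)
  eval-sImp v (_ ∨f _) ⊥f = sym (∨-identityʳ _)
  eval-sImp v (_ ∨f _) (atom _) = refl
  eval-sImp v (_ ∨f _) (¬f _) = refl
  eval-sImp v (_ ∨f _) (_ ∧f _) = refl
  eval-sImp v (_ ∨f _) (_ ∨f _) = refl
  eval-sImp v (_ ∨f _) (_ ⇒f _) = refl
  eval-sImp v (_ ∨f _) (_ ⇔f _) = refl
  eval-sImp v (_ ⇒f _) ⊤f = sym (∨-zeroʳ _)
  eval-sImp v (_ ⇒f _) ⊥f = sym (∨-identityʳ _)
  eval-sImp v (_ ⇒f _) (atom _) = refl
  eval-sImp v (_ ⇒f _) (¬f _) = refl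
  eval-sImp v (_ ⇒f _) (_ ∧f _) = refl
  eval-sImp v (_ ⇒f _) (_ ∨f _) = refl
  eval-sImp v (_ ⇒f _) (_ ⇒f _) = refl
  eval-sImp v (_ ⇒f _) (_ ⇔f _) = refl
  eval-sImp v (_ ⇔f _) ⊤f = sym (∨-zeroʳ _)
  eval-sImp v (_ ⇔f _) ⊥f = sym (∨-identityʳ _)
  eval-sImp v (_ ⇔f _) (atom _) = refl
  eval-sImp v (_ ⇔f _) (¬f _) = refl
  eval-sImp v (_ ⇔f _) (_ ∧f _) = refl
  eval-sImp v (_ ⇔f _) (_ ∨f _) = refl
  eval-sImp v (_ ⇔f _) (_ ⇒f _) = refl
  eval-sImp v (_ ⇔f _) (_ ⇔f _) = refl

  eval-sIff : ∀ v (p q : Formula Atom) →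
    eval v (sIff p q) ≡ (if eval v p then eval v q else not (eval v q))
  eval-sIff v ⊤f q = refl
  eval-sIff v ⊥f q = eval-sNot v q
  eval-sIff v (atom _) ⊤f = sym (if-true-false _)
  eval-sIff v (atom _) ⊥f = sym (if-false-true _)
  eval-sIff v (atom _) (atom _) = refl
  eval-sIff v (atom _) (¬f _) = refl
  eval-sIff v (atom _) (_ ∧f _) = refl
  eval-sIff v (atom _) (_ ∨f _) = refl
  eval-sIff v (atom _) (_ ⇒f _) = refl
  eval-sIff v (atom _) (_ ⇔f _) = refl
  eval-sIff v (¬f _) ⊤f = sym (if-true-false _)
  eval-sIff v (¬f _) ⊥f = sym (if-false-true _)
  eval-sIff v (¬f _) (atom _) = refl
  eval-sIff v (¬f _) (¬f _) = refl
  eval-sIff v (¬f _) (_ ∧f _) = refl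
  eval-sIff v (¬f _) (_ ∨f _) = refl
  eval-sIff v (¬f _) (_ ⇒f _) = refl
  eval-sIff v (¬f _) (_ ⇔f _) = refl
  eval-sIff v (_ ∧f _) ⊤f = sym (if-true-false _)
  eval-sIff v (_ ∧f _) ⊥f = sym (if-false-true _)
  eval-sIff v (_ ∧f _) (atom _) = refl
  eval-sIff v (_ ∧f _) (¬f _) = refl
  eval-sIff v (_ ∧f _) (_ ∧f _) = refl
  eval-sIff v (_ ∧f _) (_ ∨f _) = refl
  eval-sIff v (_ ∧f _) (_ ⇒f _) = refl
  eval-sIff v (_ ∧f _) (_ ⇔f _) = refl
  eval-sIff v (_ ∨f _) ⊤f = sym (if-true-false _)
  eval-sIff v (_ ∨f _) ⊥f = sym (if-false-true _)
  eval-sIff v (_ ∨f _) (atom _) = refl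
  eval-sIff v (_ ∨f _) (¬f _) = refl
  eval-sIff v (_ ∨f _) (_ ∧f _) = refl
  eval-sIff v (_ ∨f _) (_ ∨f _) = refl
  eval-sIff v (_ ∨f _) (_ ⇒f _) = refl
  eval-sIff v (_ ∨f _) (_ ⇔f _) = refl
  eval-sIff v (_ ⇒f _) ⊤f = sym (if-true-false _)
  eval-sIff v (_ ⇒f _) ⊥f = sym (if-false-true _)
  eval-sIff v (_ ⇒f _) (atom _) = refl
  eval-sIff v (_ ⇒f _) (¬f _) = refl
  eval-sIff v (_ ⇒f _) (_ ∧f _) = refl
  eval-sIff v (_ ⇒f _) (_ ∨f _) = refl
  eval-sIff v (_ ⇒f _) (_ ⇒f _) = refl
  eval-sIff v (_ ⇒f _) (_ ⇔f _) = refl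
  eval-sIff v (_ ⇔f _) ⊤f = sym (if-true-false _)
  eval-sIff v (_ ⇔f _) ⊥f = sym (if-false-true _)
  eval-sIff v (_ ⇔f _) (atom _) = refl
  eval-sIff v (_ ⇔f _) (¬f _) = refl
  eval-sIff v (_ ⇔f _) (_ ∧f _) = refl
  eval-sIff v (_ ⇔f _) (_ ∨f _) = refl
  eval-sIff v (_ ⇔f _) (_ ⇒f _) = refl
  eval-sIff v (_ ⇔f _) (_ ⇔f _) = refl

  eval-constant : ∀ v (b : Bool) → eval {Atom} v (if b then ⊤f else ⊥f) ≡ b
  eval-constant v true = refl
  eval-constant v false = refl

  eval-substProp : (_≟_ : DecidableEquality Atom) → ∀ v a b → v a ≡ b →
    ∀ φ → eval v (substProp _≟_ a b φ) ≡ eval v φ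
  eval-substProp _≟_ v a b va≡b = go
    where
    sub : Formula Atom → Formula Atom
    sub = substProp _≟_ a b

    go : ∀ φ → eval v (sub φ) ≡ eval v φ
    go (atom x) with x ≟ a
    ... | yes refl = trans (eval-constant v b) (sym va≡b)
    ... | no _ = refl
    go ⊤f = refl
    go ⊥f = refl
    go (¬f φ) = trans (eval-sNot v (sub φ)) (cong not (go φ))
    go (φ ∧f ψ) = trans (eval-sAnd v (sub φ) (sub ψ)) (cong₂ _∧_ (go φ) (go ψ))
    go (φ ∨f ψ) = trans (eval-sOr v (sub φ) (sub ψ)) (cong₂ _∨_ (go φ) (go ψ))
    go (φ ⇒f ψ) =
      trans (eval-sImp v (sub φ) (sub ψ)) (cong₂ (λ x y → not x ∨ y) (go φ) (go ψ))
    go (φ ⇔f ψ) =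
      trans (eval-sIff v (sub φ) (sub ψ)) (cong₂ (λ x y → if x then y else not y) (go φ) (go ψ))

  eval-litF-sound : ∀ (w : Atom → Bool) a b → eval w (litF a b) ≡ true → w a ≡ b
  eval-litF-sound w a true wa = wa
  eval-litF-sound w a false ¬wa = trans (sym (not-involutive (w a))) (cong not ¬wa)

  eval-litF-complete : ∀ (w : Atom → Bool) a b → w a ≡ b → eval w (litF a b) ≡ true
  eval-litF-complete w a true wa = wa
  eval-litF-complete w a false wa = cong not wa

  eval-litF-not : ∀ (w : Atom → Bool) a b →
    eval w (litF a (not b)) ≡ not (eval w (litF a b))
  eval-litF-not w a true = refl
  eval-litF-not w a false = sym (not-involutive (w a))

  eval-residual : (_≟_ : DecidableEquality Atom) → ∀ {α} v (φ : Formula Atom)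
    (l : Literal α) → eval v (toFormula l) ≡ true →
    eval v (residual _≟_ φ l) ≡ eval v φ
  eval-residual _≟_ v φ l lᵛ =
    eval-substProp _≟_ v (litAtom l) (polarity l) (eval-litF-sound v _ _ lᵛ) φ

  eval-cong-atoms : ∀ (w v : Atom → Bool) φ →
    All (λ a → w a ≡ v a) (atoms φ) → eval w φ ≡ eval v φ
  eval-cong-atoms w v (atom x) (wx≡vx All.∷ _) = wx≡vx
  eval-cong-atoms w v ⊤f _ = refl
  eval-cong-atoms w v ⊥f _ = refl
  eval-cong-atoms w v (¬f φ) w≗v = cong not (eval-cong-atoms w v φ w≗v)
  eval-cong-atoms w v (φ ∧f ψ) w≗v =
    cong₂ _∧_
      (eval-cong-atoms w v φ (++⁻ˡ (atoms φ) w≗v)) (eval-cong-atoms w v ψ (++⁻ʳ (atoms φ) w≗v))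
  eval-cong-atoms w v (φ ∨f ψ) w≗v =
    cong₂ _∨_
      (eval-cong-atoms w v φ (++⁻ˡ (atoms φ) w≗v)) (eval-cong-atoms w v ψ (++⁻ʳ (atoms φ) w≗v))
  eval-cong-atoms w v (φ ⇒f ψ) w≗v =
    cong₂ (λ x y → not x ∨ y)
      (eval-cong-atoms w v φ (++⁻ˡ (atoms φ) w≗v)) (eval-cong-atoms w v ψ (++⁻ʳ (atoms φ) w≗v))
  eval-cong-atoms w v (φ ⇔f ψ) w≗v =
    cong₂ (λ x y → if x then y else not y)
      (eval-cong-atoms w v φ (++⁻ˡ (atoms φ) w≗v)) (eval-cong-atoms w v ψ (++⁻ʳ (atoms φ) w≗v))

  eval-assignment-self : ∀ v (α : List Atom) → eval v (assignment α v) ≡ true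
  eval-assignment-self v [] = refl
  eval-assignment-self v (a ∷ α) =
    cong₂ _∧_ (eval-litF-complete v a (v a) refl) (eval-assignment-self v α)

  eval-assignment-agree : ∀ w v (α : List Atom) → eval w (assignment α v) ≡ true →
    ∀ {a} → a ∈ α → w a ≡ v a
  eval-assignment-agree w v (b ∷ α) w⊨ρ (here refl) =
    eval-litF-sound w b (v b) (∧-conicalˡ _ _ w⊨ρ)
  eval-assignment-agree w v (b ∷ α) w⊨ρ (there a∈α) =
    eval-assignment-agree w v α (∧-conicalʳ _ _ w⊨ρ) a∈α

  TExtended-intro : ∀ T α (ψ : Formula Atom) →
    (∀ v → ¬ TSat T (assignment α v) → eval v ψ ≡ true) → TExtended T α ψ
  TExtended-intro T α ψ holds ρ ((v , refl) , unsat , ρ⊨¬ψ) =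
    not-¬ refl (trans (holds v unsat) (sym (ρ⊨¬ψ v (eval-assignment-self v α))))

  TExtended-elim : ∀ T α (φ : Formula Atom) → All (_∈ α) (atoms φ) → TExtended T α φ →
    ∀ v → ¬ TSat T (assignment α v) → eval v φ ≡ true
  TExtended-elim T α φ atoms⊆α ext v unsat = ¬-not λ φᵛ≡false →
    ext (assignment α v) ((v , refl) , unsat , λ w w⊨ρ →
      cong not (trans (eval-cong-atoms w v φ (w≗v-on-φ w w⊨ρ)) φᵛ≡false))
    where
    w≗v-on-φ : ∀ w → eval w (assignment α v) ≡ true → All (λ a → w a ≡ v a) (atoms φ)
    w≗v-on-φ w w⊨ρ = All.map (eval-assignment-agree w v α w⊨ρ) atoms⊆α

  negLit-∨-intro : ∀ {α} v (l : Literal α) (ψ : Formula Atom) →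
    (eval v (toFormula l) ≡ true → eval v ψ ≡ true) → eval v (negLit l ∨f ψ) ≡ true
  negLit-∨-intro v l ψ l⇒ψ =
    trans (cong (_∨ eval v ψ) (eval-litF-not v (litAtom l) (polarity l)))
          (not-∨-intro (eval v (toFormula l)) l⇒ψ)

lemmaA4 : {Atom : Set} (_≟_ : DecidableEquality Atom) (T : Theory Atom)
    (α : List Atom) (φ : Formula Atom) →
    All (_∈ α) (atoms φ) →
    TExtended T α φ →
    (l : Literal α) →
    TExtended T α (negLit l ∨f residual _≟_ φ l)
      × TExtended T α (negLit l ∨f (residual _≟_ φ l ∧f toFormula l))
lemmaA4 {Atom} _≟_ T α φ atoms⊆α ext l =
  TExtended-intro T α (negLit l ∨f φₗ) (λ v unsat →
    negLit-∨-intro v l φₗ (residual-holds v unsat)) ,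
  TExtended-intro T α (negLit l ∨f (φₗ ∧f toFormula l)) (λ v unsat →
    negLit-∨-intro v l (φₗ ∧f toFormula l) λ lᵛ →
      trans (cong (_∧ eval v (toFormula l)) (residual-holds v unsat lᵛ)) lᵛ)
  where
  φₗ : Formula Atom
  φₗ = residual _≟_ φ l

  residual-holds : ∀ v → ¬ TSat T (assignment α v) →
    eval v (toFormula l) ≡ true → eval v φₗ ≡ true
  residual-holds v unsat lᵛ =
    trans (eval-residual _≟_ v φ l lᵛ) (TExtended-elim T α φ atoms⊆α ext v unsat)
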